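{- Let $d$ be a derivation in $\mathbf{\forall^1 FL_e}$ of a sequent $\Gamma(\bar w,y),\Pi(\bar w,z)\Rightarrow\Delta(\bar w,z)$, where $y\neq z$ and $x\notin\bar w\cup\{y,z\}$. Then there exist a formula $\chi(\bar w)\in\mathrm{Fm}^{1+}_\forall(\mathcal{L}_s)$ and derivations $d_1,d_2$ in $\mathbf{\forall^1FL_e}$ with $\mathrm{md}(d_1),\mathrm{md}(d_2)\le\mathrm{md}(d)$ such that $d_1$ derives $\Gamma(\bar w,y)\Rightarrow\chi(\bar w)$ and $d_2$ derives $\Pi(\bar w,z),\chi(\bar w)\Rightarrow\Delta(\bar w,z)$.
   Context: $\mathcal{L}_s$ is the signature with binary $\land,\lor,\cdot,\to$ and constants ${\rm f},{\rm e}$. $\mathrm{Fm}^{1+}_\forall(\mathcal{L}_s)$ is the set of first-order formulas built from unary predicates $P_i$ ($i\in\mathbb{N}$), variables $x$ and $x_i$ ($i\in\mathbb{N}$), connectives of $\mathcal{L}_s$, and quantifiers $\forall x,\exists x$ (only $x$ is quantified), such that no occurrence of any $x_i$ lies within the scope of a quantifier. Notation $\varphi(\bar w)$ means all free variables of $\varphi$ lie in the set $\bar w$; $\varphi(\bar w,y)$ means free variables lie in $\bar w\cup\{y\}$ with $y\notin\bar w$; for a multiset $\Gamma$, $\Gamma(\bar w,y)$ means this holds for each member. A sequent is $\Gamma\Rightarrow\Delta$ with $\Gamma,\Delta$ finite multisets of formulas of $\mathrm{Fm}^{1+}_\forall(\mathcal{L}_s)$, $\Delta$ having at most one element; comma denotes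 multiset sum. The calculus $\mathbf{\forall^1FL_e}$ has axioms $\varphi\Rightarrow\varphi$, ${\rm f}\Rightarrow$, $\Rightarrow{\rm e}$, and rules (premises above, conclusion after $/$): $\Gamma\Rightarrow\Delta\,/\,\Gamma,{\rm e}\Rightarrow\Delta$; $\Gamma\Rightarrow\,/\,\Gamma\Rightarrow{\rm f}$; $\Gamma_1\Rightarrow\varphi$ and $\Gamma_2,\psi\Rightarrow\Delta\,/\,\Gamma_1,\Gamma_2,\varphi\to\psi\Rightarrow\Delta$; $\Gamma,\varphi\Rightarrow\psi\,/\,\Gamma\Rightarrow\varphi\to\psi$; $\Gamma,\varphi,\psi\Rightarrow\Delta\,/\,\Gamma,\varphi\cdot\psi\Rightarrow\Delta$; $\Gamma_1\Rightarrow\varphi$ and $\Gamma_2\Rightarrow\psi\,/\,\Gamma_1,\Gamma_2\Rightarrow\varphi\cdot\psi$; $\Gamma,\varphi\Rightarrow\Delta\,/\,\Gamma,\varphi\land\psi\Rightarrow\Delta$ and $\Gamma,\psi\Rightarrow\Delta\,/\,\Gamma,\varphi\land\psi\Rightarrow\Delta$; $\Gamma\Rightarrow\varphi$ and $\Gamma\Rightarrow\psi\,/\,\Gamma\Rightarrow\varphi\land\psi$; $\Gamma,\varphi\Rightarrow\Delta$ and $\Gamma,\psi\Rightarrow\Delta\,/\,\Gamma,\varphi\lor\psi\Rightarrow\Delta$; $\Gamma\Rightarrow\varphi\,/\,\Gamma\Rightarrow\varphi\lor\psi$ and $\Gamma\Rightarrow\psi\,/\,\Gamma\Rightarrow\varphi\lor\psi$;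 $(\forall\Rightarrow)$: $\Gamma,\varphi(u)\Rightarrow\Delta\,/\,\Gamma,\forall x\varphi(x)\Rightarrow\Delta$; $(\Rightarrow\forall)$: $\Gamma\Rightarrow\psi(y)\,/\,\Gamma\Rightarrow\forall x\psi(x)$; $(\exists\Rightarrow)$: $\Gamma,\varphi(y)\Rightarrow\Delta\,/\,\Gamma,\exists x\varphi(x)\Rightarrow\Delta$; $(\Rightarrow\exists)$: $\Gamma\Rightarrow\psi(u)\,/\,\Gamma\Rightarrow\exists x\psi(x)$. Side conditions: (i) in $(\forall\Rightarrow)$ and $(\Rightarrow\exists)$, if the conclusion contains at least one free occurrence of a variable, then $u$ also occurs freely in the conclusion; (ii) in $(\Rightarrow\forall)$ and $(\exists\Rightarrow)$, $y$ does not occur freely in the conclusion. For a derivation $d$, $\mathrm{md}(d)$ is the maximum number of applications of $(\Rightarrow\forall)$ and $(\exists\Rightarrow)$ occurring on a branch of $d$. -}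

module Defs where

open import Data.Nat using (ℕ; suc; _⊔_)
open import Data.List using (List; []; _∷_; _++_; [_])
open import Data.List.Relation.Unary.Any using (Any)
open import Data.List.Relation.Unary.All using (All)
open import Data.List.Relation.Binary.Permutation.Propositional using (_↭_)
open import Data.Maybe using (Maybe; just; nothing)
open import Data.Product using (∃)
open import Data.Sum using (_⊎_)
open import Data.Empty using (⊥)
open import Relation.Binary.PropositionalEquality using (_≡_)
open import Relation.Nullary using (¬_)

-- Variables: the distinguished (quantifiable) variable x, and x_i (i ∈ ℕ).
data Var : Set where
  vx  : Var
  xs  : ℕ → Var

-- Bodies of quantified formulas: since no x_i may occur in the scope of a
-- quantifier, the only variable occurring there is x (possibly re-bound by
-- nested quantifiers).  batom i stands for P_i(x).
data Body : Set where
  batom : ℕ → Body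
  _b∧_ _b∨_ _b·_ _b⇒_ : Body → Body → Body
  bf be : Body
  b∀ b∃ : Body → Body

-- Formulas of Fm^{1+}_∀(L_s).  atom i v stands for P_i(v);
-- all φ / ex φ stand for ∀x φ(x) / ∃x φ(x).
data Fm : Set where
  atom : ℕ → Var → Fm
  _∧_ _∨_ _·_ _⇒_ : Fm → Fm → Fm
  f e : Fm
  all ex : Body → Fm

inst : Body → Var → Fm
inst (batom i) u = atom i u
inst (φ b∧ ψ) u = inst φ u ∧ inst ψ u
inst (φ b∨ ψ) u = inst φ u ∨ inst ψ u
inst (φ b· ψ) u = inst φ u · inst ψ u
inst (φ b⇒ ψ) u = inst φ u ⇒ inst ψ u
inst bf u = f
inst be u = e
inst (b∀ φ) u = all φ
inst (b∃ φ) u = ex φ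

data FreeIn (v : Var) : Fm → Set where
  fatom : ∀ {i} → FreeIn v (atom i v)
  f∧l : ∀ {φ ψ} → FreeIn v φ → FreeIn v (φ ∧ ψ)
  f∧r : ∀ {φ ψ} → FreeIn v ψ → FreeIn v (φ ∧ ψ)
  f∨l : ∀ {φ ψ} → FreeIn v φ → FreeIn v (φ ∨ ψ)
  f∨r : ∀ {φ ψ} → FreeIn v ψ → FreeIn v (φ ∨ ψ)
  f·l : ∀ {φ ψ} → FreeIn v φ → FreeIn v (φ · ψ)
  f·r : ∀ {φ ψ} → FreeIn v ψ → FreeIn v (φ · ψ)
  f⇒l : ∀ {φ ψ} → FreeIn v φ → FreeIn v (φ ⇒ ψ)
  f⇒r : ∀ {φ ψ} → FreeIn v ψ → FreeIn v (φ ⇒ ψ)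

FreeInM : Var → Maybe Fm → Set
FreeInM v nothing  = ⊥
FreeInM v (just φ) = FreeIn v φ

OccSeq : Var → List Fm → Maybe Fm → Set
OccSeq v Γ Δ = Any (FreeIn v) Γ ⊎ FreeInM v Δ

FVin : List Var → Fm → Set
FVin ws φ = ∀ v → FreeIn v φ → Any (v ≡_) ws

FVinM : List Var → Maybe Fm → Set
FVinM ws Δ = ∀ v → FreeInM v Δ → Any (v ≡_) ws

infix 4 _⊢_

-- Derivations in ∀¹FL_e.  Sequents Γ ⇒ Δ: Γ a list (read as a multiset,
-- via the structural rule `perm`), Δ : Maybe Fm (at most one formula).
data _⊢_ : List Fm → Maybe Fm → Set where
  ax   : ∀ φ → [ φ ] ⊢ just φ
  axf  : [ f ] ⊢ nothing
  axe  : [] ⊢ just e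
  perm : ∀ {Γ Γ' Δ} → Γ ↭ Γ' → Γ ⊢ Δ → Γ' ⊢ Δ
  eL   : ∀ {Γ Δ} → Γ ⊢ Δ → Γ ++ [ e ] ⊢ Δ
  fR   : ∀ {Γ} → Γ ⊢ nothing → Γ ⊢ just f
  ⇒L   : ∀ {Γ₁ Γ₂ φ ψ Δ} → Γ₁ ⊢ just φ → Γ₂ ++ [ ψ ] ⊢ Δ →
         Γ₁ ++ Γ₂ ++ [ φ ⇒ ψ ] ⊢ Δ
  ⇒R   : ∀ {Γ φ ψ} → Γ ++ [ φ ] ⊢ just ψ → Γ ⊢ just (φ ⇒ ψ)
  ·L   : ∀ {Γ φ ψ Δ} → Γ ++ φ ∷ ψ ∷ [] ⊢ Δ → Γ ++ [ φ · ψ ] ⊢ Δ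
  ·R   : ∀ {Γ₁ Γ₂ φ ψ} → Γ₁ ⊢ just φ → Γ₂ ⊢ just ψ → Γ₁ ++ Γ₂ ⊢ just (φ · ψ)
  ∧L₁  : ∀ {Γ φ ψ Δ} → Γ ++ [ φ ] ⊢ Δ → Γ ++ [ φ ∧ ψ ] ⊢ Δ
  ∧L₂  : ∀ {Γ φ ψ Δ} → Γ ++ [ ψ ] ⊢ Δ → Γ ++ [ φ ∧ ψ ] ⊢ Δ
  ∧R   : ∀ {Γ φ ψ} → Γ ⊢ just φ → Γ ⊢ just ψ → Γ ⊢ just (φ ∧ ψ)
  ∨L   : ∀ {Γ φ ψ Δ} → Γ ++ [ φ ] ⊢ Δ → Γ ++ [ ψ ] ⊢ Δ → Γ ++ [ φ ∨ ψ ] ⊢ Δ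
  ∨R₁  : ∀ {Γ φ ψ} → Γ ⊢ just φ → Γ ⊢ just (φ ∨ ψ)
  ∨R₂  : ∀ {Γ φ ψ} → Γ ⊢ just ψ → Γ ⊢ just (φ ∨ ψ)
  ∀L   : ∀ {Γ φ Δ} (u : Var) →
         ((∃ λ v → OccSeq v (Γ ++ [ all φ ]) Δ) → OccSeq u (Γ ++ [ all φ ]) Δ) →
         Γ ++ [ inst φ u ] ⊢ Δ → Γ ++ [ all φ ] ⊢ Δ
  ∀R   : ∀ {Γ ψ} (y : Var) → ¬ OccSeq y Γ (just (all ψ)) →
         Γ ⊢ just (inst ψ y) → Γ ⊢ just (all ψ)
  ∃L   : ∀ {Γ φ Δ} (y : Var) → ¬ OccSeq y (Γ ++ [ ex φ ]) Δ →
         Γ ++ [ inst φ y ] ⊢ Δ → Γ ++ [ ex φ ] ⊢ Δ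
  ∃R   : ∀ {Γ ψ} (u : Var) →
         ((∃ λ v → OccSeq v Γ (just (ex ψ))) → OccSeq u Γ (just (ex ψ))) →
         Γ ⊢ just (inst ψ u) → Γ ⊢ just (ex ψ)

md : ∀ {Γ Δ} → Γ ⊢ Δ → ℕ
md (ax φ) = 0
md axf = 0
md axe = 0
md (perm _ d) = md d
md (eL d) = md d
md (fR d) = md d
md (⇒L d d') = md d ⊔ md d'
md (⇒R d) = md d
md (·L d) = md d
md (·R d d') = md d ⊔ md d'
md (∧L₁ d) = md d
md (∧L₂ d) = md d
md (∧R d d') = md d ⊔ md d'
md (∨L d d') = md d ⊔ md d'
md (∨R₁ d) = md d
md (∨R₂ d) = md d
md (∀L _ _ d) = md d
md (∀R _ _ d) = suc (md d)
md (∃L _ _ d) = suc (md d)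
md (∃R _ _ d) = md d

-- Maehara's method: by induction on d, every way of splitting the antecedent
-- as an interleaving of Γˡ and Γʳ has an interpolant χ, with Γˡ ⇒ χ and
-- Γʳ, χ ⇒ Δ derivable by derivations whose md is bounded by md d, and every
-- free variable of χ occurring both in Γˡ and in Γʳ ⇒ Δ.  Eigenvariable rules
-- are replayed on the side of their principal formula; their freshness
-- condition survives because the variables of χ occur in the conclusion.  The
-- instantiation rules (∀⇒), (⇒∃) need their variable u to occur in the
-- conclusion; when u is absent from the side of the principal formula, the
-- instance is moved to the other side and the quantified formula, which is
-- closed in this fragment, travels inside the interpolant as χ · ∀xφ,
-- ∀xφ → χ or χ → ∃xψ.  The lemma is the split (Γ, Π): a variable of χ lies in
-- y ∷ w̄ and in z ∷ w̄, hence in w̄.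

{-# OPTIONS --safe #-}
module Submission where

open import Defs
open import Level using (Level; 0ℓ)
open import Data.Nat using (ℕ; suc; _≤_; _⊔_; _≟_; z≤n; s≤s)
open import Data.Nat.Properties using (≤-refl; ≤-trans; ⊔-mono-≤; ⊔-lub; m≤n⇒m≤1+n)
open import Data.List using (List; []; _∷_; _++_; [_])
open import Data.List.Properties using (++-assoc)
open import Data.List.Relation.Unary.All using (All; lookupWith)
open import Data.List.Relation.Unary.Any using (Any; here; there; any?)
open import Data.List.Relation.Unary.Any.Properties using (++⁺ˡ; ++⁺ʳ; ++⁻)
import Data.List.Relation.Binary.Pointwise.Properties as Pointwise
open import Data.List.Relation.Binary.Permutation.Propositional as ↭
  using (_↭_; ↭-refl; ↭-sym; ↭-trans; ↭-reflexive; module PermutationReasoning)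
open import Data.List.Relation.Binary.Permutation.Propositional.Properties
  using (Any-resp-↭; shift; ++-comm) renaming (++⁺ˡ to ↭-++⁺ˡ; ++⁺ʳ to ↭-++⁺ʳ)
open import Data.List.Relation.Ternary.Interleaving using ([]; left; swap)
open import Data.List.Relation.Ternary.Interleaving.Propositional
  using (Interleaving; consˡ; consʳ; toPermutation)
open import Data.List.Relation.Ternary.Interleaving.Propositional.Properties using (++-linear)
open import Data.Maybe using (Maybe; just; nothing)
open import Data.Product using (Σ; _,_; proj₂; ∃₂; _×_)
open import Data.Sum as Sum using (_⊎_; inj₁; inj₂; [_,_]′)
open import Data.Empty using (⊥-elim)
open import Function using (_∘_; id)
open import Relation.Binary.Definitions using (DecidableEquality)
open import Relation.Binary.PropositionalEquality using (_≡_; refl; sym; cong)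
open import Relation.Nullary using (¬_; yes; no)
open import Relation.Nullary.Decidable using (map′; _⊎-dec_)
open import Relation.Unary using (Pred; Decidable; Satisfiable; _∈_; _∉_; _⊆_; _≐_; _∪_)

private
  variable
    ℓ ℓ′ : Level
    A : Set ℓ
    a : A
    ss ts l r : List A
    Γ Γˡ Γʳ Λ Λˡ Λʳ : List Fm
    φ ψ : Fm
    β : Body
    Δ : Maybe Fm
    m n : ℕ
    u v y : Var

-- Free variables

xs-injective : xs m ≡ xs n → m ≡ n
xs-injective refl = refl

_≟ᵥ_ : DecidableEquality Var
vx   ≟ᵥ vx   = yes refl
vx   ≟ᵥ xs _ = no λ ()
xs _ ≟ᵥ vx   = no λ ()
xs m ≟ᵥ xs n = map′ (cong xs) xs-injective (m ≟ n)

fv : Fm → Pred Var 0ℓ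
fv φ v = FreeIn v φ

fvᴹ : Maybe Fm → Pred Var 0ℓ
fvᴹ Δ v = FreeInM v Δ

fvᶜ : List Fm → Pred Var 0ℓ
fvᶜ Γ v = Any (FreeIn v) Γ

fvˢ : List Fm → Maybe Fm → Pred Var 0ℓ
fvˢ Γ Δ v = OccSeq v Γ Δ

fv? : ∀ φ → Decidable (fv φ)
fv? (atom i w) v = map′ (λ { refl → fatom }) (λ { fatom → refl }) (v ≟ᵥ w)
fv? (φ ∧ ψ) v = map′ [ f∧l , f∧r ]′ (λ { (f∧l p) → inj₁ p ; (f∧r p) → inj₂ p }) (fv? φ v ⊎-dec fv? ψ v)
fv? (φ ∨ ψ) v = map′ [ f∨l , f∨r ]′ (λ { (f∨l p) → inj₁ p ; (f∨r p) → inj₂ p }) (fv? φ v ⊎-dec fv? ψ v)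
fv? (φ · ψ) v = map′ [ f·l , f·r ]′ (λ { (f·l p) → inj₁ p ; (f·r p) → inj₂ p }) (fv? φ v ⊎-dec fv? ψ v)
fv? (φ ⇒ ψ) v = map′ [ f⇒l , f⇒r ]′ (λ { (f⇒l p) → inj₁ p ; (f⇒r p) → inj₂ p }) (fv? φ v ⊎-dec fv? ψ v)
fv? f       v = no λ ()
fv? e       v = no λ ()
fv? (all _) v = no λ ()
fv? (ex _)  v = no λ ()

fvᴹ? : ∀ Δ → Decidable (fvᴹ Δ)
fvᴹ? nothing  v = no λ ()
fvᴹ? (just φ) v = fv? φ v

fvᶜ? : ∀ Γ → Decidable (fvᶜ Γ)
fvᶜ? Γ v = any? (λ φ → fv? φ v) Γ

fvˢ? : ∀ Γ Δ → Decidable (fvˢ Γ Δ)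
fvˢ? Γ Δ v = fvᶜ? Γ v ⊎-dec fvᴹ? Δ v

fv-inst : ∀ β → v ∈ fv (inst β u) → v ≡ u
fv-inst (batom i) fatom   = refl
fv-inst (β b∧ γ)  (f∧l p) = fv-inst β p
fv-inst (β b∧ γ)  (f∧r p) = fv-inst γ p
fv-inst (β b∨ γ)  (f∨l p) = fv-inst β p
fv-inst (β b∨ γ)  (f∨r p) = fv-inst γ p
fv-inst (β b· γ)  (f·l p) = fv-inst β p
fv-inst (β b· γ)  (f·r p) = fv-inst γ p
fv-inst (β b⇒ γ)  (f⇒l p) = fv-inst β p
fv-inst (β b⇒ γ)  (f⇒r p) = fv-inst γ p

fvᶜ-snoc⁻ : ∀ Γ → v ∈ fvᶜ (Γ ++ [ φ ]) → v ∈ fvᶜ Γ ⊎ v ∈ fv φ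
fvᶜ-snoc⁻ Γ p with ++⁻ Γ p
... | inj₁ q        = inj₁ q
... | inj₂ (here q) = inj₂ q

fvᶜ-snoc⁺ : ∀ Γ → fv φ ⊆ fvᶜ (Γ ++ [ φ ])
fvᶜ-snoc⁺ Γ p = ++⁺ʳ Γ (here p)

fvᶜ-snoc-mono : ∀ Γ → fv φ ⊆ fv ψ → fvᶜ (Γ ++ [ φ ]) ⊆ fvᶜ (Γ ++ [ ψ ])
fvᶜ-snoc-mono Γ φ⊆ψ p = [ ++⁺ˡ , fvᶜ-snoc⁺ Γ ∘ φ⊆ψ ]′ (fvᶜ-snoc⁻ Γ p)

fvᶜ-snoc-inst⁻ : ∀ Γ β → v ∈ fvᶜ (Γ ++ [ inst β u ]) → v ∈ fvᶜ Γ ⊎ v ≡ u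
fvᶜ-snoc-inst⁻ Γ β p = Sum.map₂ (fv-inst β) (fvᶜ-snoc⁻ Γ p)

fv-·⁺ : fvᶜ (φ ∷ ψ ∷ []) ⊆ fv (φ · ψ)
fv-·⁺ (here p)         = f·l p
fv-·⁺ (there (here p)) = f·r p

fvˢ-++⁺ˡ : fvˢ Γ Δ ⊆ fvˢ (Γ ++ Λ) Δ
fvˢ-++⁺ˡ = Sum.map₁ ++⁺ˡ

fvˢ-snoc-mono : ∀ Γ → fv φ ⊆ fv ψ → fvˢ (Γ ++ [ φ ]) Δ ⊆ fvˢ (Γ ++ [ ψ ]) Δ
fvˢ-snoc-mono Γ φ⊆ψ = Sum.map₁ (fvᶜ-snoc-mono Γ φ⊆ψ)

fvˢ-snoc-inst⁻ : ∀ Γ β → v ∈ fvˢ (Γ ++ [ inst β u ]) Δ → v ∈ fvˢ Γ Δ ⊎ v ≡ u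
fvˢ-snoc-inst⁻ Γ β (inj₁ p) = Sum.map₁ inj₁ (fvᶜ-snoc-inst⁻ Γ β p)
fvˢ-snoc-inst⁻ Γ β (inj₂ p) = inj₁ (inj₂ p)

-- Interleavings

data ++-Split {A : Set ℓ} (ss ts : List A) : List A → List A → Set ℓ where
  _++ˢ_ : ∀ {l₁ r₁ l₂ r₂} → Interleaving l₁ r₁ ss → Interleaving l₂ r₂ ts →
          ++-Split ss ts (l₁ ++ l₂) (r₁ ++ r₂)

++-split : ∀ ss → Interleaving l r (ss ++ ts) → ++-Split ss ts l r
++-split []       sp         = [] ++ˢ sp
++-split (_ ∷ ss) (consˡ sp) with ++-split ss sp
... | sp₁ ++ˢ sp₂ = consˡ sp₁ ++ˢ sp₂
++-split (_ ∷ ss) (consʳ sp) with ++-split ss sp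
... | sp₁ ++ˢ sp₂ = consʳ sp₁ ++ˢ sp₂

data SnocSplit {A : Set ℓ} (ss : List A) (a : A) : List A → List A → Set ℓ where
  snocˡ : Interleaving l r ss → SnocSplit ss a (l ++ [ a ]) r
  snocʳ : Interleaving l r ss → SnocSplit ss a l (r ++ [ a ])

snoc-split : ∀ ss → Interleaving l r (ss ++ [ a ]) → SnocSplit ss a l r
snoc-split []       (consˡ []) = snocˡ []
snoc-split []       (consʳ []) = snocʳ []
snoc-split (_ ∷ ss) (consˡ sp) with snoc-split ss sp
... | snocˡ sp′ = snocˡ (consˡ sp′)
... | snocʳ sp′ = snocʳ (consˡ sp′)
snoc-split (_ ∷ ss) (consʳ sp) with snoc-split ss sp
... | snocˡ sp′ = snocˡ (consʳ sp′)
... | snocʳ sp′ = snocʳ (consʳ sp′)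

appendˡ : ∀ ts → Interleaving l r ss → Interleaving (l ++ ts) r (ss ++ ts)
appendˡ ts []         = left (Pointwise.refl refl)
appendˡ ts (consˡ sp) = consˡ (appendˡ ts sp)
appendˡ ts (consʳ sp) = consʳ (appendˡ ts sp)

appendʳ : ∀ ts → Interleaving l r ss → Interleaving l (r ++ ts) (ss ++ ts)
appendʳ ts = swap ∘ appendˡ ts ∘ swap

Interleaving-transport-↭ : ss ↭ ts → Interleaving l r ts →
                           ∃₂ λ l′ r′ → Interleaving l′ r′ ss × l′ ↭ l × r′ ↭ r
Interleaving-transport-↭ ↭.refl sp = _ , _ , sp , ↭-refl , ↭-refl
Interleaving-transport-↭ (↭.prep a p) (consˡ sp) with Interleaving-transport-↭ p sp
... | _ , _ , sp′ , pˡ , pʳ = _ , _ , consˡ sp′ , ↭.prep a pˡ , pʳ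
Interleaving-transport-↭ (↭.prep a p) (consʳ sp) with Interleaving-transport-↭ p sp
... | _ , _ , sp′ , pˡ , pʳ = _ , _ , consʳ sp′ , pˡ , ↭.prep a pʳ
Interleaving-transport-↭ (↭.swap a b p) (consˡ (consˡ sp)) with Interleaving-transport-↭ p sp
... | _ , _ , sp′ , pˡ , pʳ = _ , _ , consˡ (consˡ sp′) , ↭.swap a b pˡ , pʳ
Interleaving-transport-↭ (↭.swap a b p) (consˡ (consʳ sp)) with Interleaving-transport-↭ p sp
... | _ , _ , sp′ , pˡ , pʳ = _ , _ , consʳ (consˡ sp′) , ↭.prep b pˡ , ↭.prep a pʳ
Interleaving-transport-↭ (↭.swap a b p) (consʳ (consˡ sp)) with Interleaving-transport-↭ p sp
... | _ , _ , sp′ , pˡ , pʳ = _ , _ , consˡ (consʳ sp′) , ↭.prep a pˡ , ↭.prep b pʳ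
Interleaving-transport-↭ (↭.swap a b p) (consʳ (consʳ sp)) with Interleaving-transport-↭ p sp
... | _ , _ , sp′ , pˡ , pʳ = _ , _ , consʳ (consʳ sp′) , pˡ , ↭.swap a b pʳ
Interleaving-transport-↭ (↭.trans p q) sp with Interleaving-transport-↭ q sp
... | _ , _ , sp₁ , q₁ˡ , q₁ʳ with Interleaving-transport-↭ p sp₁
... | _ , _ , sp₂ , p₂ˡ , p₂ʳ = _ , _ , sp₂ , ↭-trans p₂ˡ q₁ˡ , ↭-trans p₂ʳ q₁ʳ

module _ {P : Pred A ℓ′} where

  Any-interleaving⁻ : Interleaving l r ss → Any P ss → Any P l ⊎ Any P r
  Any-interleaving⁻ sp = ++⁻ _ ∘ Any-resp-↭ (toPermutation sp)

  Any-interleaving⁺ : Interleaving l r ss → Any P l ⊎ Any P r → Any P ss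
  Any-interleaving⁺ sp = Any-resp-↭ (↭-sym (toPermutation sp)) ∘ [ ++⁺ˡ , ++⁺ʳ _ ]′

-- Interpolants

fvᵖ : List Fm → List Fm → Maybe Fm → Pred Var 0ℓ
fvᵖ Γˡ Γʳ Δ = fvᶜ Γˡ ∪ fvˢ Γʳ Δ

fvˢ-interleaving : Interleaving Γˡ Γʳ Γ → fvˢ Γ Δ ≐ fvᵖ Γˡ Γʳ Δ
fvˢ-interleaving sp = [ Sum.map₂ inj₁ ∘ Any-interleaving⁻ sp , inj₂ ∘ inj₂ ]′
                    , [ inj₁ ∘ Any-interleaving⁺ sp ∘ inj₁ , Sum.map₁ (Any-interleaving⁺ sp ∘ inj₂) ]′

-- Side condition (i) of (∀⇒) and (⇒∃), P being the variables of the conclusion.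
Admissible : Pred Var 0ℓ → Var → Set
Admissible P u = Satisfiable P → u ∈ P

Admissible-transfer : ∀ {P Q : Pred Var 0ℓ} → (∀ {v} → v ∈ Q → v ∈ P ⊎ u ∈ Q) →
                      (u ∈ P → u ∈ Q) → Admissible P u → Admissible Q u
Admissible-transfer Q⊆P⊎u back adm (v , q) = [ (λ p → back (adm (v , p))) , id ]′ (Q⊆P⊎u q)

Admissible-resp-≐ : ∀ {P Q : Pred Var 0ℓ} → P ≐ Q → Admissible P u → Admissible Q u
Admissible-resp-≐ (P⊆Q , Q⊆P) = Admissible-transfer (inj₁ ∘ Q⊆P) P⊆Q

swap-suffixes : ∀ (ss ts us : List A) → (ss ++ ts) ++ us ↭ (ss ++ us) ++ ts
swap-suffixes ss ts us = begin
  (ss ++ ts) ++ us  ≡⟨ ++-assoc ss ts us ⟩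
  ss ++ ts ++ us    ↭⟨ ↭-++⁺ˡ ss (++-comm ts us) ⟩
  ss ++ us ++ ts    ≡⟨ sym (++-assoc ss us ts) ⟩
  (ss ++ us) ++ ts  ∎
  where open PermutationReasoning

pull-lasts : ∀ (ss ts : List A) a b → (ss ++ [ a ]) ++ (ts ++ [ b ]) ↭ (ss ++ ts) ++ a ∷ b ∷ []
pull-lasts ss ts a b = begin
  (ss ++ [ a ]) ++ ts ++ [ b ]  ≡⟨ ++-assoc ss [ a ] (ts ++ [ b ]) ⟩
  ss ++ a ∷ ts ++ [ b ]         ↭⟨ ↭-++⁺ˡ ss (↭-sym (shift a ts [ b ])) ⟩
  ss ++ ts ++ a ∷ b ∷ []        ≡⟨ sym (++-assoc ss ts (a ∷ b ∷ [])) ⟩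
  (ss ++ ts) ++ a ∷ b ∷ []      ∎
  where open PermutationReasoning

exchange : ∀ {Γ φ ψ Δ} → (Γ ++ [ φ ]) ++ [ ψ ] ⊢ Δ → (Γ ++ [ ψ ]) ++ [ φ ] ⊢ Δ
exchange {Γ} = perm (swap-suffixes Γ _ _)

record Interpolant (Γˡ Γʳ : List Fm) (Δ : Maybe Fm) (n : ℕ) : Set where
  constructor interpolant
  field
    χ   : Fm
    fvˡ : fv χ ⊆ fvᶜ Γˡ
    fvʳ : fv χ ⊆ fvˢ Γʳ Δ
    dˡ  : Γˡ ⊢ just χ
    dʳ  : Γʳ ++ [ χ ] ⊢ Δ
    mdˡ : md dˡ ≤ n
    mdʳ : md dʳ ≤ n

e-interpolant : (d : Γ ⊢ Δ) → Interpolant [] Γ Δ (md d)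
e-interpolant d = interpolant e (λ ()) (λ ()) axe (eL d) z≤n ≤-refl

interp-perm : Γˡ ↭ Λˡ → Γʳ ↭ Λʳ → Interpolant Γˡ Γʳ Δ n → Interpolant Λˡ Λʳ Δ n
interp-perm pˡ pʳ (interpolant χ fvˡ fvʳ dˡ dʳ mdˡ mdʳ) =
  interpolant χ (Any-resp-↭ pˡ ∘ fvˡ) (Sum.map₁ (Any-resp-↭ pʳ) ∘ fvʳ)
    (perm pˡ dˡ) (perm (↭-++⁺ʳ [ χ ] pʳ) dʳ) mdˡ mdʳ

interp-eLˡ : Interpolant Γˡ Γʳ Δ n → Interpolant (Γˡ ++ [ e ]) Γʳ Δ n
interp-eLˡ (interpolant χ fvˡ fvʳ dˡ dʳ mdˡ mdʳ) =
  interpolant χ (++⁺ˡ ∘ fvˡ) fvʳ (eL dˡ) dʳ mdˡ mdʳ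

interp-eLʳ : Interpolant Γˡ Γʳ Δ n → Interpolant Γˡ (Γʳ ++ [ e ]) Δ n
interp-eLʳ (interpolant χ fvˡ fvʳ dˡ dʳ mdˡ mdʳ) =
  interpolant χ fvˡ (fvˢ-++⁺ˡ ∘ fvʳ) dˡ (exchange (eL dʳ)) mdˡ mdʳ

module _ (Θ : List Fm)
         (R : ∀ {Γ Δ} → Γ ++ Θ ⊢ Δ → Γ ++ [ φ ] ⊢ Δ)
         (md-R : ∀ {Γ Δ} (d : Γ ++ Θ ⊢ Δ) → md (R d) ≤ md d)
         (fv-R : fvᶜ Θ ⊆ fv φ) where

  interp-leftRuleˡ : Interpolant (Γˡ ++ Θ) Γʳ Δ n → Interpolant (Γˡ ++ [ φ ]) Γʳ Δ n
  interp-leftRuleˡ {Γˡ = Γˡ} (interpolant χ fvˡ fvʳ dˡ dʳ mdˡ mdʳ) =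
    interpolant χ ([ ++⁺ˡ , fvᶜ-snoc⁺ Γˡ ∘ fv-R ]′ ∘ ++⁻ Γˡ ∘ fvˡ) fvʳ
      (R dˡ) dʳ (≤-trans (md-R dˡ) mdˡ) mdʳ

  interp-leftRuleʳ : Interpolant Γˡ (Γʳ ++ Θ) Δ n → Interpolant Γˡ (Γʳ ++ [ φ ]) Δ n
  interp-leftRuleʳ {Γʳ = Γʳ} (interpolant χ fvˡ fvʳ dˡ dʳ mdˡ mdʳ) =
    interpolant χ fvˡ (Sum.map₁ ([ ++⁺ˡ , fvᶜ-snoc⁺ Γʳ ∘ fv-R ]′ ∘ ++⁻ Γʳ) ∘ fvʳ)
      dˡ (exchange (R (perm (swap-suffixes Γʳ Θ [ χ ]) dʳ))) mdˡ (≤-trans (md-R _) mdʳ)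

interp-rightRule : (R : ∀ {Γ} → Γ ⊢ Δ → Γ ⊢ just φ) → (∀ {Γ} (d : Γ ⊢ Δ) → md (R d) ≤ md d) →
                   fvᴹ Δ ⊆ fv φ → Interpolant Γˡ Γʳ Δ n → Interpolant Γˡ Γʳ (just φ) n
interp-rightRule R md-R fv-R (interpolant χ fvˡ fvʳ dˡ dʳ mdˡ mdʳ) =
  interpolant χ fvˡ (Sum.map₂ fv-R ∘ fvʳ) dˡ (R dʳ) mdˡ (≤-trans (md-R dʳ) mdʳ)

interp-⇒R : Interpolant Γˡ (Γʳ ++ [ φ ]) (just ψ) n → Interpolant Γˡ Γʳ (just (φ ⇒ ψ)) n
interp-⇒R {Γʳ = Γʳ} (interpolant χ fvˡ fvʳ dˡ dʳ mdˡ mdʳ) =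
  interpolant χ fvˡ (fv-⇒ ∘ fvʳ) dˡ (⇒R (exchange dʳ)) mdˡ mdʳ
  where
  fv-⇒ : fvˢ (Γʳ ++ [ φ ]) (just ψ) ⊆ fvˢ Γʳ (just (φ ⇒ ψ))
  fv-⇒ (inj₁ p) = Sum.map₂ f⇒l (fvᶜ-snoc⁻ Γʳ p)
  fv-⇒ (inj₂ p) = inj₂ (f⇒r p)

interp-∧R : Interpolant Γˡ Γʳ (just φ) m → Interpolant Γˡ Γʳ (just ψ) n →
            Interpolant Γˡ Γʳ (just (φ ∧ ψ)) (m ⊔ n)
interp-∧R (interpolant χ₁ fvˡ₁ fvʳ₁ dˡ₁ dʳ₁ mdˡ₁ mdʳ₁) (interpolant χ₂ fvˡ₂ fvʳ₂ dˡ₂ dʳ₂ mdˡ₂ mdʳ₂) =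
  interpolant (χ₁ ∧ χ₂)
    (λ { (f∧l p) → fvˡ₁ p ; (f∧r p) → fvˡ₂ p })
    (λ { (f∧l p) → Sum.map₂ f∧l (fvʳ₁ p) ; (f∧r p) → Sum.map₂ f∧r (fvʳ₂ p) })
    (∧R dˡ₁ dˡ₂) (∧R (∧L₁ dʳ₁) (∧L₂ dʳ₂)) (⊔-mono-≤ mdˡ₁ mdˡ₂) (⊔-mono-≤ mdʳ₁ mdʳ₂)

interp-·R : Interpolant Γˡ Γʳ (just φ) m → Interpolant Λˡ Λʳ (just ψ) n →
            Interpolant (Γˡ ++ Λˡ) (Γʳ ++ Λʳ) (just (φ · ψ)) (m ⊔ n)
interp-·R {Γʳ = Γʳ} {Λʳ = Λʳ}
          (interpolant χ₁ fvˡ₁ fvʳ₁ dˡ₁ dʳ₁ mdˡ₁ mdʳ₁) (interpolant χ₂ fvˡ₂ fvʳ₂ dˡ₂ dʳ₂ mdˡ₂ mdʳ₂) =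
  interpolant (χ₁ · χ₂)
    (λ { (f·l p) → ++⁺ˡ (fvˡ₁ p) ; (f·r p) → ++⁺ʳ _ (fvˡ₂ p) })
    (λ { (f·l p) → Sum.map ++⁺ˡ f·l (fvʳ₁ p) ; (f·r p) → Sum.map (++⁺ʳ Γʳ) f·r (fvʳ₂ p) })
    (·R dˡ₁ dˡ₂) (·L (perm (pull-lasts Γʳ Λʳ χ₁ χ₂) (·R dʳ₁ dʳ₂)))
    (⊔-mono-≤ mdˡ₁ mdˡ₂) (⊔-mono-≤ mdʳ₁ mdʳ₂)

interp-∨Lˡ : Interpolant (Γˡ ++ [ φ ]) Γʳ Δ m → Interpolant (Γˡ ++ [ ψ ]) Γʳ Δ n →
             Interpolant (Γˡ ++ [ φ ∨ ψ ]) Γʳ Δ (m ⊔ n)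
interp-∨Lˡ {Γˡ = Γˡ}
           (interpolant χ₁ fvˡ₁ fvʳ₁ dˡ₁ dʳ₁ mdˡ₁ mdʳ₁) (interpolant χ₂ fvˡ₂ fvʳ₂ dˡ₂ dʳ₂ mdˡ₂ mdʳ₂) =
  interpolant (χ₁ ∨ χ₂)
    (λ { (f∨l p) → fvᶜ-snoc-mono Γˡ f∨l (fvˡ₁ p) ; (f∨r p) → fvᶜ-snoc-mono Γˡ f∨r (fvˡ₂ p) })
    (λ { (f∨l p) → fvʳ₁ p ; (f∨r p) → fvʳ₂ p })
    (∨L (∨R₁ dˡ₁) (∨R₂ dˡ₂)) (∨L dʳ₁ dʳ₂) (⊔-mono-≤ mdˡ₁ mdˡ₂) (⊔-mono-≤ mdʳ₁ mdʳ₂)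

interp-∨Lʳ : Interpolant Γˡ (Γʳ ++ [ φ ]) Δ m → Interpolant Γˡ (Γʳ ++ [ ψ ]) Δ n →
             Interpolant Γˡ (Γʳ ++ [ φ ∨ ψ ]) Δ (m ⊔ n)
interp-∨Lʳ {Γʳ = Γʳ}
           (interpolant χ₁ fvˡ₁ fvʳ₁ dˡ₁ dʳ₁ mdˡ₁ mdʳ₁) (interpolant χ₂ fvˡ₂ fvʳ₂ dˡ₂ dʳ₂ mdˡ₂ mdʳ₂) =
  interpolant (χ₁ ∧ χ₂)
    (λ { (f∧l p) → fvˡ₁ p ; (f∧r p) → fvˡ₂ p })
    (λ { (f∧l p) → fvˢ-snoc-mono Γʳ f∨l (fvʳ₁ p) ; (f∧r p) → fvˢ-snoc-mono Γʳ f∨r (fvʳ₂ p) })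
    (∧R dˡ₁ dˡ₂) (exchange (∨L (exchange (∧L₁ dʳ₁)) (exchange (∧L₂ dʳ₂))))
    (⊔-mono-≤ mdˡ₁ mdˡ₂) (⊔-mono-≤ mdʳ₁ mdʳ₂)

interp-⇒Lˡ : Interpolant Λʳ Λˡ (just φ) m → Interpolant (Γˡ ++ [ ψ ]) Γʳ Δ n →
             Interpolant (Λˡ ++ Γˡ ++ [ φ ⇒ ψ ]) (Λʳ ++ Γʳ) Δ (m ⊔ n)
interp-⇒Lˡ {Λʳ = Λʳ} {Λˡ = Λˡ} {φ = φ} {Γˡ = Γˡ} {ψ = ψ} {Γʳ = Γʳ} {Δ = Δ}
           (interpolant χ₁ fvˡ₁ fvʳ₁ dˡ₁ dʳ₁ mdˡ₁ mdʳ₁) (interpolant χ₂ fvˡ₂ fvʳ₂ dˡ₂ dʳ₂ mdˡ₂ mdʳ₂) =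
  interpolant (χ₁ ⇒ χ₂) fvˡ′ fvʳ′
    (⇒R (perm (swap-suffixes Λˡ [ χ₁ ] (Γˡ ++ [ φ ⇒ ψ ])) (⇒L dʳ₁ dˡ₂)))
    (perm (↭-reflexive (sym (++-assoc Λʳ _ [ χ₁ ⇒ χ₂ ]))) (⇒L dˡ₁ dʳ₂))
    (⊔-mono-≤ mdʳ₁ mdˡ₂) (⊔-mono-≤ mdˡ₁ mdʳ₂)
  where
  fv-principal : fv (φ ⇒ ψ) ⊆ fvᶜ (Λˡ ++ Γˡ ++ [ φ ⇒ ψ ])
  fv-principal = ++⁺ʳ Λˡ ∘ fvᶜ-snoc⁺ Γˡ
  fvˡ′ : fv (χ₁ ⇒ χ₂) ⊆ fvᶜ (Λˡ ++ Γˡ ++ [ φ ⇒ ψ ])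
  fvˡ′ (f⇒l p) = [ ++⁺ˡ , fv-principal ∘ f⇒l ]′ (fvʳ₁ p)
  fvˡ′ (f⇒r p) = [ ++⁺ʳ Λˡ ∘ ++⁺ˡ , fv-principal ∘ f⇒r ]′ (fvᶜ-snoc⁻ Γˡ (fvˡ₂ p))
  fvʳ′ : fv (χ₁ ⇒ χ₂) ⊆ fvˢ (Λʳ ++ Γʳ) Δ
  fvʳ′ (f⇒l p) = inj₁ (++⁺ˡ (fvˡ₁ p))
  fvʳ′ (f⇒r p) = Sum.map₁ (++⁺ʳ Λʳ) (fvʳ₂ p)

interp-⇒Lʳ : Interpolant Λˡ Λʳ (just φ) m → Interpolant Γˡ (Γʳ ++ [ ψ ]) Δ n →
             Interpolant (Λˡ ++ Γˡ) (Λʳ ++ Γʳ ++ [ φ ⇒ ψ ]) Δ (m ⊔ n)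
interp-⇒Lʳ {Λˡ = Λˡ} {Λʳ = Λʳ} {φ = φ} {Γˡ = Γˡ} {Γʳ = Γʳ} {ψ = ψ} {Δ = Δ}
           (interpolant χ₁ fvˡ₁ fvʳ₁ dˡ₁ dʳ₁ mdˡ₁ mdʳ₁) (interpolant χ₂ fvˡ₂ fvʳ₂ dˡ₂ dʳ₂ mdˡ₂ mdʳ₂) =
  interpolant (χ₁ · χ₂) fvˡ′ fvʳ′ (·R dˡ₁ dˡ₂) (·L (perm reorder (⇒L dʳ₁ (exchange dʳ₂))))
    (⊔-mono-≤ mdˡ₁ mdˡ₂) (⊔-mono-≤ mdʳ₁ mdʳ₂)
  where
  reorder : (Λʳ ++ [ χ₁ ]) ++ (Γʳ ++ [ χ₂ ]) ++ [ φ ⇒ ψ ] ↭ (Λʳ ++ Γʳ ++ [ φ ⇒ ψ ]) ++ χ₁ ∷ χ₂ ∷ []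
  reorder = ↭-trans (↭-++⁺ˡ (Λʳ ++ [ χ₁ ]) (swap-suffixes Γʳ [ χ₂ ] [ φ ⇒ ψ ]))
                    (pull-lasts Λʳ (Γʳ ++ [ φ ⇒ ψ ]) χ₁ χ₂)
  fv-principal : fv (φ ⇒ ψ) ⊆ fvᶜ (Λʳ ++ Γʳ ++ [ φ ⇒ ψ ])
  fv-principal = ++⁺ʳ Λʳ ∘ fvᶜ-snoc⁺ Γʳ
  fvˡ′ : fv (χ₁ · χ₂) ⊆ fvᶜ (Λˡ ++ Γˡ)
  fvˡ′ (f·l p) = ++⁺ˡ (fvˡ₁ p)
  fvˡ′ (f·r p) = ++⁺ʳ _ (fvˡ₂ p)
  fvʳ′ : fv (χ₁ · χ₂) ⊆ fvˢ (Λʳ ++ Γʳ ++ [ φ ⇒ ψ ]) Δ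
  fvʳ′ (f·l p) = inj₁ ([ ++⁺ˡ , fv-principal ∘ f⇒l ]′ (fvʳ₁ p))
  fvʳ′ (f·r p) with fvʳ₂ p
  ... | inj₁ q = inj₁ ([ ++⁺ʳ Λʳ ∘ ++⁺ˡ , fv-principal ∘ f⇒r ]′ (fvᶜ-snoc⁻ Γʳ q))
  ... | inj₂ q = inj₂ q

interp-∀Lˡ-here : u ∈ fvᶜ Γˡ → Interpolant (Γˡ ++ [ inst β u ]) Γʳ Δ n →
                  Interpolant (Γˡ ++ [ all β ]) Γʳ Δ n
interp-∀Lˡ-here {Γˡ = Γˡ} {β = β} u∈Γˡ (interpolant χ fvˡ fvʳ dˡ dʳ mdˡ mdʳ) =
  interpolant χ (fvˡ′ ∘ fvᶜ-snoc-inst⁻ Γˡ β ∘ fvˡ) fvʳ (∀L _ (λ _ → inj₁ (++⁺ˡ u∈Γˡ)) dˡ) dʳ mdˡ mdʳ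
  where
  fvˡ′ : v ∈ fvᶜ Γˡ ⊎ v ≡ _ → v ∈ fvᶜ (Γˡ ++ [ all β ])
  fvˡ′ (inj₁ p)    = ++⁺ˡ p
  fvˡ′ (inj₂ refl) = ++⁺ˡ u∈Γˡ

interp-∀Lˡ-there : u ∉ fvᶜ Γˡ → Admissible (fvᵖ (Γˡ ++ [ all β ]) Γʳ Δ) u →
                   Interpolant Γˡ (Γʳ ++ [ inst β u ]) Δ n →
                   Interpolant (Γˡ ++ [ all β ]) Γʳ Δ n
interp-∀Lˡ-there {u = u} {Γˡ = Γˡ} {β = β} {Γʳ = Γʳ} {Δ = Δ} u∉Γˡ adm
                 (interpolant χ fvˡ fvʳ dˡ dʳ mdˡ mdʳ) =
  interpolant (χ · all β) (λ { (f·l p) → ++⁺ˡ (fvˡ p) }) (λ { (f·l p) → fvʳ′ p })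
    (·R dˡ (ax (all β)))
    (·L (perm (↭-reflexive (++-assoc Γʳ [ χ ] [ all β ])) (∀L u adm′ (exchange dʳ))))
    (⊔-lub mdˡ z≤n) mdʳ
  where
  fvʳ′ : fv χ ⊆ fvˢ Γʳ Δ
  fvʳ′ p = [ id , (λ { refl → ⊥-elim (u∉Γˡ (fvˡ p)) }) ]′ (fvˢ-snoc-inst⁻ Γʳ β (fvʳ p))
  into : fvˢ ((Γʳ ++ [ χ ]) ++ [ all β ]) Δ ⊆ fvᵖ (Γˡ ++ [ all β ]) Γʳ Δ
  into (inj₁ p) with fvᶜ-snoc⁻ (Γʳ ++ [ χ ]) p
  ... | inj₁ q = [ inj₂ ∘ inj₁ , inj₁ ∘ ++⁺ˡ ∘ fvˡ ]′ (fvᶜ-snoc⁻ Γʳ q)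
  into (inj₂ p) = inj₂ (inj₂ p)
  back : u ∈ fvᵖ (Γˡ ++ [ all β ]) Γʳ Δ → u ∈ fvˢ ((Γʳ ++ [ χ ]) ++ [ all β ]) Δ
  back (inj₁ p) with fvᶜ-snoc⁻ Γˡ p
  ... | inj₁ q = ⊥-elim (u∉Γˡ q)
  back (inj₂ p) = fvˢ-++⁺ˡ (fvˢ-++⁺ˡ p)
  adm′ : Admissible (fvˢ ((Γʳ ++ [ χ ]) ++ [ all β ]) Δ) u
  adm′ = Admissible-transfer (inj₁ ∘ into) back adm

interp-∀Lʳ-here : u ∈ fvˢ Γʳ Δ → Interpolant Γˡ (Γʳ ++ [ inst β u ]) Δ n →
                  Interpolant Γˡ (Γʳ ++ [ all β ]) Δ n
interp-∀Lʳ-here {u = u} {Γʳ = Γʳ} {Δ = Δ} {β = β} u∈Γʳ (interpolant χ fvˡ fvʳ dˡ dʳ mdˡ mdʳ) =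
  interpolant χ fvˡ (fvʳ′ ∘ fvˢ-snoc-inst⁻ Γʳ β ∘ fvʳ) dˡ
    (exchange (∀L u (λ _ → fvˢ-++⁺ˡ (fvˢ-++⁺ˡ u∈Γʳ)) (exchange dʳ))) mdˡ mdʳ
  where
  fvʳ′ : v ∈ fvˢ Γʳ Δ ⊎ v ≡ u → v ∈ fvˢ (Γʳ ++ [ all β ]) Δ
  fvʳ′ (inj₁ p)    = fvˢ-++⁺ˡ p
  fvʳ′ (inj₂ refl) = fvˢ-++⁺ˡ u∈Γʳ

interp-∀Lʳ-there : u ∉ fvˢ Γʳ Δ → Admissible (fvᵖ Γˡ (Γʳ ++ [ all β ]) Δ) u →
                   Interpolant (Γˡ ++ [ inst β u ]) Γʳ Δ n →
                   Interpolant Γˡ (Γʳ ++ [ all β ]) Δ n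
interp-∀Lʳ-there {u = u} {Γʳ = Γʳ} {Δ = Δ} {Γˡ = Γˡ} {β = β} u∉Γʳ adm
                 (interpolant χ fvˡ fvʳ dˡ dʳ mdˡ mdʳ) =
  interpolant (all β ⇒ χ) (λ { (f⇒r p) → fvˡ′ p }) (λ { (f⇒r p) → fvˢ-++⁺ˡ (fvʳ p) })
    (⇒R (∀L u adm′ dˡ))
    (perm (↭-++⁺ʳ [ all β ⇒ χ ] (++-comm [ all β ] Γʳ)) (⇒L (ax (all β)) dʳ))
    mdˡ mdʳ
  where
  fvˡ′ : fv χ ⊆ fvᶜ Γˡ
  fvˡ′ p = [ id , (λ { refl → ⊥-elim (u∉Γʳ (fvʳ p)) }) ]′ (fvᶜ-snoc-inst⁻ Γˡ β (fvˡ p))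
  into : v ∈ fvˢ (Γˡ ++ [ all β ]) (just χ) →
         v ∈ fvᵖ Γˡ (Γʳ ++ [ all β ]) Δ ⊎ u ∈ fvˢ (Γˡ ++ [ all β ]) (just χ)
  into (inj₁ p) with fvᶜ-snoc⁻ Γˡ p
  ... | inj₁ q = inj₁ (inj₁ q)
  into (inj₂ p) with fvᶜ-snoc-inst⁻ Γˡ β (fvˡ p)
  ... | inj₁ q    = inj₁ (inj₁ q)
  ... | inj₂ refl = inj₂ (inj₂ p)
  back : u ∈ fvᵖ Γˡ (Γʳ ++ [ all β ]) Δ → u ∈ fvˢ (Γˡ ++ [ all β ]) (just χ)
  back (inj₁ p) = inj₁ (++⁺ˡ p)
  back (inj₂ (inj₁ p)) with fvᶜ-snoc⁻ Γʳ p
  ... | inj₁ q = ⊥-elim (u∉Γʳ (inj₁ q))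
  back (inj₂ (inj₂ p)) = ⊥-elim (u∉Γʳ (inj₂ p))
  adm′ : Admissible (fvˢ (Γˡ ++ [ all β ]) (just χ)) u
  adm′ = Admissible-transfer into back adm

interp-∃Lˡ : y ∉ fvᵖ (Γˡ ++ [ ex β ]) Γʳ Δ → Interpolant (Γˡ ++ [ inst β y ]) Γʳ Δ n →
             Interpolant (Γˡ ++ [ ex β ]) Γʳ Δ (suc n)
interp-∃Lˡ {y = y} {Γˡ = Γˡ} {β = β} fresh (interpolant χ fvˡ fvʳ dˡ dʳ mdˡ mdʳ) =
  interpolant χ fvˡ′ fvʳ (∃L y fresh′ dˡ) dʳ (s≤s mdˡ) (m≤n⇒m≤1+n mdʳ)
  where
  fvˡ′ : fv χ ⊆ fvᶜ (Γˡ ++ [ ex β ])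
  fvˡ′ p = [ ++⁺ˡ , (λ { refl → ⊥-elim (fresh (inj₂ (fvʳ p))) }) ]′ (fvᶜ-snoc-inst⁻ Γˡ β (fvˡ p))
  fresh′ : y ∉ fvˢ (Γˡ ++ [ ex β ]) (just χ)
  fresh′ (inj₁ p) = fresh (inj₁ p)
  fresh′ (inj₂ p) = fresh (inj₂ (fvʳ p))

interp-∃Lʳ : y ∉ fvᵖ Γˡ (Γʳ ++ [ ex β ]) Δ → Interpolant Γˡ (Γʳ ++ [ inst β y ]) Δ n →
             Interpolant Γˡ (Γʳ ++ [ ex β ]) Δ (suc n)
interp-∃Lʳ {y = y} {Γʳ = Γʳ} {β = β} {Δ = Δ} fresh (interpolant χ fvˡ fvʳ dˡ dʳ mdˡ mdʳ) =
  interpolant χ fvˡ fvʳ′ dˡ (exchange (∃L y fresh′ (exchange dʳ))) (m≤n⇒m≤1+n mdˡ) (s≤s mdʳ)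
  where
  fvʳ′ : fv χ ⊆ fvˢ (Γʳ ++ [ ex β ]) Δ
  fvʳ′ p = [ fvˢ-++⁺ˡ , (λ { refl → ⊥-elim (fresh (inj₁ (fvˡ p))) }) ]′ (fvˢ-snoc-inst⁻ Γʳ β (fvʳ p))
  fresh′ : y ∉ fvˢ ((Γʳ ++ [ χ ]) ++ [ ex β ]) Δ
  fresh′ (inj₁ p) with fvᶜ-snoc⁻ (Γʳ ++ [ χ ]) p
  ... | inj₁ q = [ fresh ∘ inj₂ ∘ inj₁ ∘ ++⁺ˡ , fresh ∘ inj₁ ∘ fvˡ ]′ (fvᶜ-snoc⁻ Γʳ q)
  fresh′ (inj₂ p) = fresh (inj₂ (inj₂ p))

interp-∀R : y ∉ fvᵖ Γˡ Γʳ (just (all β)) → Interpolant Γˡ Γʳ (just (inst β y)) n →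
            Interpolant Γˡ Γʳ (just (all β)) (suc n)
interp-∀R {y = y} {Γʳ = Γʳ} {β = β} fresh (interpolant χ fvˡ fvʳ dˡ dʳ mdˡ mdʳ) =
  interpolant χ fvˡ fvʳ′ dˡ (∀R y fresh′ dʳ) (m≤n⇒m≤1+n mdˡ) (s≤s mdʳ)
  where
  fvʳ′ : fv χ ⊆ fvˢ Γʳ (just (all β))
  fvʳ′ p with fvʳ p
  ... | inj₁ q = inj₁ q
  ... | inj₂ q with fv-inst β q
  ... | refl = ⊥-elim (fresh (inj₁ (fvˡ p)))
  fresh′ : y ∉ fvˢ (Γʳ ++ [ χ ]) (just (all β))
  fresh′ (inj₁ p) = [ fresh ∘ inj₂ ∘ inj₁ , fresh ∘ inj₁ ∘ fvˡ ]′ (fvᶜ-snoc⁻ Γʳ p)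

interp-∃R-here : u ∈ fvᶜ Γʳ → Interpolant Γˡ Γʳ (just (inst β u)) n →
                 Interpolant Γˡ Γʳ (just (ex β)) n
interp-∃R-here {u = u} {Γʳ = Γʳ} {β = β} u∈Γʳ (interpolant χ fvˡ fvʳ dˡ dʳ mdˡ mdʳ) =
  interpolant χ fvˡ fvʳ′ dˡ (∃R u (λ _ → inj₁ (++⁺ˡ u∈Γʳ)) dʳ) mdˡ mdʳ
  where
  fvʳ′ : fv χ ⊆ fvˢ Γʳ (just (ex β))
  fvʳ′ p with fvʳ p
  ... | inj₁ q = inj₁ q
  ... | inj₂ q with fv-inst β q
  ... | refl = inj₁ u∈Γʳ

interp-∃R-there : u ∉ fvᶜ Γʳ → Admissible (fvᵖ Γˡ Γʳ (just (ex β))) u →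
                  Interpolant Γʳ Γˡ (just (inst β u)) n →
                  Interpolant Γˡ Γʳ (just (ex β)) n
interp-∃R-there {u = u} {Γʳ = Γʳ} {Γˡ = Γˡ} {β = β} u∉Γʳ adm (interpolant χ fvˡ fvʳ dˡ dʳ mdˡ mdʳ) =
  interpolant (χ ⇒ ex β) (λ { (f⇒l p) → fvˡ′ p }) (λ { (f⇒l p) → inj₁ (fvˡ p) })
    (⇒R (∃R u adm′ dʳ)) (⇒L {Γ₂ = []} dˡ (ax (ex β))) mdʳ (⊔-lub mdˡ z≤n)
  where
  fvˡ′ : fv χ ⊆ fvᶜ Γˡ
  fvˡ′ p with fvʳ p
  ... | inj₁ q = q
  ... | inj₂ q with fv-inst β q
  ... | refl = ⊥-elim (u∉Γʳ (fvˡ p))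
  into : fvˢ (Γˡ ++ [ χ ]) (just (ex β)) ⊆ fvᵖ Γˡ Γʳ (just (ex β))
  into (inj₁ p) = [ inj₁ , inj₂ ∘ inj₁ ∘ fvˡ ]′ (fvᶜ-snoc⁻ Γˡ p)
  back : u ∈ fvᵖ Γˡ Γʳ (just (ex β)) → u ∈ fvˢ (Γˡ ++ [ χ ]) (just (ex β))
  back (inj₁ p)        = inj₁ (++⁺ˡ p)
  back (inj₂ (inj₁ p)) = ⊥-elim (u∉Γʳ p)
  adm′ : Admissible (fvˢ (Γˡ ++ [ χ ]) (just (ex β))) u
  adm′ = Admissible-transfer (inj₁ ∘ into) back adm

-- The interpolation theorem

interpolate : (d : Γ ⊢ Δ) → Interleaving Γˡ Γʳ Γ → Interpolant Γˡ Γʳ Δ (md d)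
interpolate (ax φ) (consˡ []) = interpolant φ here inj₂ (ax φ) (ax φ) z≤n z≤n
interpolate (ax φ) (consʳ []) = e-interpolant (ax φ)
interpolate axf    (consˡ []) = interpolant f (λ ()) (λ ()) (ax f) axf z≤n z≤n
interpolate axf    (consʳ []) = e-interpolant axf
interpolate axe    []         = e-interpolant axe
interpolate (perm p d) sp with Interleaving-transport-↭ p sp
... | _ , _ , sp′ , pˡ , pʳ = interp-perm pˡ pʳ (interpolate d sp′)
interpolate (eL {Γ} d) sp with snoc-split Γ sp
... | snocˡ sp′ = interp-eLˡ (interpolate d sp′)
... | snocʳ sp′ = interp-eLʳ (interpolate d sp′)
interpolate (fR d) sp = interp-rightRule fR (λ _ → ≤-refl) (λ ()) (interpolate d sp)
interpolate (⇒L {Γ₁} {Γ₂} d₁ d₂) sp with ++-split Γ₁ sp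
... | sp₁ ++ˢ sp₂ with snoc-split Γ₂ sp₂
...   | snocˡ sp₂′ = interp-⇒Lˡ (interpolate d₁ (swap sp₁)) (interpolate d₂ (appendˡ _ sp₂′))
...   | snocʳ sp₂′ = interp-⇒Lʳ (interpolate d₁ sp₁) (interpolate d₂ (appendʳ _ sp₂′))
interpolate (⇒R d) sp = interp-⇒R (interpolate d (appendʳ _ sp))
interpolate (·L {Γ} d) sp with snoc-split Γ sp
... | snocˡ sp′ = interp-leftRuleˡ (_ ∷ _ ∷ []) ·L (λ _ → ≤-refl) fv-·⁺ (interpolate d (appendˡ _ sp′))
... | snocʳ sp′ = interp-leftRuleʳ (_ ∷ _ ∷ []) ·L (λ _ → ≤-refl) fv-·⁺ (interpolate d (appendʳ _ sp′))
interpolate (·R {Γ₁} d₁ d₂) sp with ++-split Γ₁ sp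
... | sp₁ ++ˢ sp₂ = interp-·R (interpolate d₁ sp₁) (interpolate d₂ sp₂)
interpolate (∧L₁ {Γ} d) sp with snoc-split Γ sp
... | snocˡ sp′ = interp-leftRuleˡ [ _ ] ∧L₁ (λ _ → ≤-refl) (λ { (here p) → f∧l p })
                                  (interpolate d (appendˡ _ sp′))
... | snocʳ sp′ = interp-leftRuleʳ [ _ ] ∧L₁ (λ _ → ≤-refl) (λ { (here p) → f∧l p })
                                  (interpolate d (appendʳ _ sp′))
interpolate (∧L₂ {Γ} d) sp with snoc-split Γ sp
... | snocˡ sp′ = interp-leftRuleˡ [ _ ] ∧L₂ (λ _ → ≤-refl) (λ { (here p) → f∧r p })
                                  (interpolate d (appendˡ _ sp′))
... | snocʳ sp′ = interp-leftRuleʳ [ _ ] ∧L₂ (λ _ → ≤-refl) (λ { (here p) → f∧r p })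
                                  (interpolate d (appendʳ _ sp′))
interpolate (∧R d₁ d₂) sp = interp-∧R (interpolate d₁ sp) (interpolate d₂ sp)
interpolate (∨L {Γ} d₁ d₂) sp with snoc-split Γ sp
... | snocˡ sp′ = interp-∨Lˡ (interpolate d₁ (appendˡ _ sp′)) (interpolate d₂ (appendˡ _ sp′))
... | snocʳ sp′ = interp-∨Lʳ (interpolate d₁ (appendʳ _ sp′)) (interpolate d₂ (appendʳ _ sp′))
interpolate (∨R₁ d) sp = interp-rightRule ∨R₁ (λ _ → ≤-refl) f∨l (interpolate d sp)
interpolate (∨R₂ d) sp = interp-rightRule ∨R₂ (λ _ → ≤-refl) f∨r (interpolate d sp)
interpolate (∀L {Γ} {Δ = Δ} u adm d) sp with snoc-split Γ sp
... | snocˡ {l = Γˡ} sp′ with fvᶜ? Γˡ u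
...   | yes u∈Γˡ = interp-∀Lˡ-here u∈Γˡ (interpolate d (appendˡ _ sp′))
...   | no  u∉Γˡ = interp-∀Lˡ-there u∉Γˡ (Admissible-resp-≐ (fvˢ-interleaving sp) adm)
                                   (interpolate d (appendʳ _ sp′))
interpolate (∀L {Γ} {Δ = Δ} u adm d) sp | snocʳ {r = Γʳ} sp′ with fvˢ? Γʳ Δ u
...   | yes u∈Γʳ = interp-∀Lʳ-here u∈Γʳ (interpolate d (appendʳ _ sp′))
...   | no  u∉Γʳ = interp-∀Lʳ-there u∉Γʳ (Admissible-resp-≐ (fvˢ-interleaving sp) adm)
                                   (interpolate d (appendˡ _ sp′))
interpolate (∀R y fresh d) sp = interp-∀R (fresh ∘ proj₂ (fvˢ-interleaving sp)) (interpolate d sp)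
interpolate (∃L {Γ} y fresh d) sp with snoc-split Γ sp
... | snocˡ sp′ = interp-∃Lˡ (fresh ∘ proj₂ (fvˢ-interleaving sp)) (interpolate d (appendˡ _ sp′))
... | snocʳ sp′ = interp-∃Lʳ (fresh ∘ proj₂ (fvˢ-interleaving sp)) (interpolate d (appendʳ _ sp′))
interpolate {Γʳ = Γʳ} (∃R u adm d) sp with fvᶜ? Γʳ u
... | yes u∈Γʳ = interp-∃R-here u∈Γʳ (interpolate d sp)
... | no  u∉Γʳ = interp-∃R-there u∉Γʳ (Admissible-resp-≐ (fvˢ-interleaving sp) adm)
                                 (interpolate d (swap sp))

All-FVin⇒fvᶜ⊆ : ∀ {ws} → All (FVin ws) Γ → v ∈ fvᶜ Γ → Any (v ≡_) ws
All-FVin⇒fvᶜ⊆ fvΓ p = lookupWith (λ fvφ q → fvφ _ q) fvΓ p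

lemma5p2 : (ws : List Var) (y z : Var) (Γ Π : List Fm) (Δ : Maybe Fm) →
    ¬ y ≡ z → ¬ Any (vx ≡_) (y ∷ z ∷ ws) →
    ¬ Any (y ≡_) ws → ¬ Any (z ≡_) ws →
    All (FVin (y ∷ ws)) Γ → All (FVin (z ∷ ws)) Π → FVinM (z ∷ ws) Δ →
    (d : Γ ++ Π ⊢ Δ) →
    Σ Fm λ χ → FVin ws χ ×
      Σ (Γ ⊢ just χ) λ d₁ → Σ (Π ++ [ χ ] ⊢ Δ) λ d₂ →
        md d₁ ≤ md d × md d₂ ≤ md d
lemma5p2 ws y z Γ Π Δ y≢z _ y∉ws _ fvΓ fvΠ fvΔ d = χ , χ⊆ws , dˡ , dʳ , mdˡ , mdʳ
  where
  open Interpolant (interpolate d (++-linear Γ Π))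
  χ⊆ws : FVin ws χ
  χ⊆ws v p with All-FVin⇒fvᶜ⊆ fvΓ (fvˡ p)
  ... | there v∈ws = v∈ws
  ... | here refl with [ All-FVin⇒fvᶜ⊆ fvΠ , fvΔ _ ]′ (fvʳ p)
  ...   | here y≡z   = ⊥-elim (y≢z y≡z)
  ...   | there y∈ws = ⊥-elim (y∉ws y∈ws)
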